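{- Let $\ell\ge 3$ and $d\ge 1$ be integers. Then for every integer $t$ with $1\le t\le \ell-2$, the number of vertices of the $t$-iterated line digraph $L^t(CK(d,\ell))$ of the cyclic Kautz digraph $CK(d,\ell)$ is $$(d^2-d+1)^t d^{\ell-t}+\tfrac{1}{2}(-1)^{\ell+1}(d-2)^t(d-1)d+\tfrac{1}{2}(-1)^{\ell} d^{t+1}(d+1).$$
   Context: Let $\Sigma$ be an alphabet of $d+1$ distinct symbols. The cyclic Kautz digraph $CK(d,\ell)$ has as vertices all words $a_1\ldots a_\ell$ over $\Sigma$ with $a_i\ne a_{i+1}$ for $1\le i\le\ell-1$ and $a_1\ne a_\ell$, and an arc from $a_1a_2\ldots a_\ell$ to $a_2\ldots a_\ell a_{\ell+1}$ whenever both words are vertices. The line digraph $L(G)$ of a digraph $G$ has as vertices the arcs of $G$, with an arc from $(u,v)$ to $(v,w)$ for all arcs $(u,v),(v,w)$ of $G$. Set $L^0(G)=G$ and $L^t(G)=L(L^{t-1}(G))$. -}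

module Defs where

open import Data.Bool using (Bool; true; false; _∧_; not)
open import Data.Nat using (ℕ; zero; suc)
open import Data.Fin using (Fin)
open import Data.Fin.Properties using () renaming (_≟_ to _≟F_)
open import Data.List using (List; []; _∷_; map; cartesianProduct; filterᵇ; length; concatMap; allFin)
open import Data.Vec using (Vec; []; _∷_; head; tail; init; last)
open import Data.Vec.Properties using (≡-dec)
open import Data.Product using (_×_; _,_)
open import Relation.Binary using (DecidableEquality)
open import Relation.Nullary.Decidable using (⌊_⌋)

-- A finite digraph: a vertex type with decidable equality, an explicit
-- duplicate-free enumeration of its vertex set, and a (boolean) arc relation.
record Digraph : Set₁ where
  field
    V     : Set
    _≟V_  : DecidableEquality V
    verts : List V
    arc   : V → V → Bool

open Digraph public

order : Digraph → ℕ
order G = length (verts G)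

L : Digraph → Digraph
L G = record
  { V     = V G × V G
  ; _≟V_  = λ { (a , b) (c , e) → decPair (_≟V_ G a c) (_≟V_ G b e) }
  ; verts = filterᵇ (λ { (u , v) → arc G u v }) (cartesianProduct (verts G) (verts G))
  ; arc   = λ { (_ , v) (v' , _) → ⌊ _≟V_ G v v' ⌋ }
  }
  where
  open import Relation.Nullary using (Dec; yes; no)
  open import Relation.Binary.PropositionalEquality using (_≡_; refl)
  decPair : ∀ {A B : Set} {a c : A} {b e : B} → Dec (a ≡ c) → Dec (b ≡ e) → Dec ((a , b) ≡ (c , e))
  decPair (yes refl) (yes refl) = yes refl
  decPair (yes refl) (no ¬p) = no λ { refl → ¬p refl }
  decPair (no ¬p) _ = no λ { refl → ¬p refl }

Lⁿ : ℕ → Digraph → Digraph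
Lⁿ zero    G = G
Lⁿ (suc t) G = L (Lⁿ t G)

allWords : (n ℓ : ℕ) → List (Vec (Fin n) ℓ)
allWords n zero    = [] ∷ []
allWords n (suc ℓ) = concatMap (λ a → map (a ∷_) (allWords n ℓ)) (allFin n)

consecDistinct : ∀ {n ℓ} → Vec (Fin n) ℓ → Bool
consecDistinct []           = true
consecDistinct (a ∷ [])     = true
consecDistinct (a ∷ b ∷ w)  = not ⌊ a ≟F b ⌋ ∧ consecDistinct (b ∷ w)

isCKWord : ∀ {n ℓ} → Vec (Fin (suc n)) (suc ℓ) → Bool
isCKWord w = consecDistinct w ∧ not ⌊ head w ≟F last w ⌋

-- cyclic Kautz digraph CK(d, ℓ) over the alphabet Fin (d+1);
-- arc a_1…a_ℓ → a_2…a_{ℓ+1} iff both are vertices, i.e. tail u = init v.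
-- (ℓ = 0 is degenerate and set to the empty digraph; it is never used.)
CK : (d ℓ : ℕ) → Digraph
CK d zero = record
  { V = Vec (Fin (suc d)) zero ; _≟V_ = ≡-dec _≟F_ ; verts = [] ; arc = λ _ _ → false }
CK d (suc m) = record
  { V     = Vec (Fin (suc d)) (suc m)
  ; _≟V_  = ≡-dec _≟F_
  ; verts = filterᵇ isCKWord (allWords (suc d) (suc m))
  ; arc   = λ u v → ⌊ ≡-dec _≟F_ (tail u) (init v) ⌋
  }

module Submission where

-- The vertices of L^t(G) are the walks of length t in G, so we count walks in CK(d, ℓ). A walk of
-- length t from a word u appends letters a₁, …, aₜ, each different from its predecessor and, since
-- t ≤ ℓ − 2, from the letter of u that is first in the new word. Splitting u = x · xs · s
-- with |xs| = t, the sum over the suffix s only sees the number of walks of length |s| in the complete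
-- digraph K_{d+1}, which is affine in the Kronecker delta of the endpoints. The remaining sum over
-- pairs of walks (the appended letters against xs) is then computed one step at a time; it stays
-- affine in two Kronecker deltas, and its three coefficients satisfy a linear recursion with
-- eigenvalues d² − d + 1, 2 − d and −d, which produce the three terms of the formula.

open import Defs
open import Data.Nat using (ℕ; zero; suc; _≤_; _<_; _∸_; s≤s) renaming (_+_ to _ℕ+_)
import Data.Nat.Properties as ℕP
open import Data.Integer using (ℤ; +_; _+_; _*_; _-_; -_; -[1+_]; _^_; 0ℤ; 1ℤ; -1ℤ)
import Data.Integer.Properties as ℤP
open import Data.Integer.Tactic.RingSolver using (solve-∀)
open import Data.Bool using (Bool; true; false; _∧_; not)
open import Data.Bool.Properties using (∧-assoc; ∧-identityʳ; ∧-conicalˡ; ∧-conicalʳ)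
open import Data.Fin using (Fin) renaming (zero to fzero; suc to fsuc)
open import Data.Fin.Properties using () renaming (_≟_ to _≟F_)
open import Data.List using (List; []; _∷_; map; cartesianProduct; filterᵇ; length; concatMap; allFin; tabulate; take) renaming (_++_ to _++ˡ_)
open import Data.Vec using (Vec; []; _∷_; tail; init; last; _∷ʳ_; _++_; toList)
open import Data.Vec.Properties using (≡-dec; last-∷ʳ)
open import Data.Product using (Σ; _×_; _,_)
open import Relation.Binary using (DecidableEquality)
open import Relation.Nullary using (¬_)
open import Relation.Nullary.Decidable using (yes; no; does; ⌊_⌋; map′; _×-dec_; isYes≗does; dec-true; dec-false; does-≡)
open import Relation.Binary.PropositionalEquality
open ≡-Reasoning
open import Algebra.Properties.Semiring.Sum ℤP.+-*-semiring
  using (sum; sum-syntax; sum-cong-≗; sum-replicate-zero; ∑-comm; ∑-distrib-+; *-distribˡ-sum; *-distribʳ-sum)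

𝟙 : Bool → ℤ
𝟙 true  = 1ℤ
𝟙 false = 0ℤ

𝟙-∧ : ∀ a b → 𝟙 (a ∧ b) ≡ 𝟙 a * 𝟙 b
𝟙-∧ true  b = sym (ℤP.*-identityˡ (𝟙 b))
𝟙-∧ false b = refl

𝟙-not : ∀ a → 𝟙 (not a) ≡ 1ℤ - 𝟙 a
𝟙-not true  = refl
𝟙-not false = refl

𝟙-idem : ∀ a → 𝟙 a * 𝟙 a ≡ 𝟙 a
𝟙-idem true  = refl
𝟙-idem false = refl

𝟙-guard : ∀ b {x y : ℤ} → (b ≡ true → x ≡ y) → 𝟙 b * x ≡ 𝟙 b * y
𝟙-guard true  x≡y = cong (1ℤ *_) (x≡y refl)
𝟙-guard false x≡y = refl

δ[_] : {A : Set} → DecidableEquality A → A → A → ℤ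
δ[ _≟_ ] x y = 𝟙 (does (x ≟ y))

private variable
  A B : Set

ΣL : List A → (A → ℤ) → ℤ
ΣL []       f = 0ℤ
ΣL (x ∷ xs) f = f x + ΣL xs f

infixl 10 ΣL
syntax ΣL xs (λ x → e) = ∑[ x ∈ xs ] e

ΣL-cong : ∀ (xs : List A) {f g : A → ℤ} → (∀ x → f x ≡ g x) → ΣL xs f ≡ ΣL xs g
ΣL-cong []       f≗g = refl
ΣL-cong (x ∷ xs) f≗g = cong₂ _+_ (f≗g x) (ΣL-cong xs f≗g)

ΣL-zero : ∀ (xs : List A) → ∑[ x ∈ xs ] 0ℤ ≡ 0ℤ
ΣL-zero []       = refl
ΣL-zero (x ∷ xs) = trans (ℤP.+-identityˡ _) (ΣL-zero xs)

ΣL-++ : ∀ (xs ys : List A) f → ΣL (xs ++ˡ ys) f ≡ ΣL xs f + ΣL ys f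
ΣL-++ []       ys f = sym (ℤP.+-identityˡ _)
ΣL-++ (x ∷ xs) ys f = trans (cong (_+_ (f x)) (ΣL-++ xs ys f)) (sym (ℤP.+-assoc (f x) _ _))

ΣL-distrib-+ : ∀ (xs : List A) f g → ∑[ x ∈ xs ] (f x + g x) ≡ ΣL xs f + ΣL xs g
ΣL-distrib-+ []       f g = refl
ΣL-distrib-+ (x ∷ xs) f g =
  trans (cong (_+_ (f x + g x)) (ΣL-distrib-+ xs f g)) (swap-middle (f x) (g x) (ΣL xs f) (ΣL xs g))
  where
  swap-middle : ∀ a b c d → a + b + (c + d) ≡ a + c + (b + d)
  swap-middle = solve-∀

ΣL-*ˡ : ∀ (xs : List A) c f → ∑[ x ∈ xs ] (c * f x) ≡ c * ΣL xs f
ΣL-*ˡ []       c f = sym (ℤP.*-zeroʳ c)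
ΣL-*ˡ (x ∷ xs) c f = trans (cong (_+_ (c * f x)) (ΣL-*ˡ xs c f)) (sym (ℤP.*-distribˡ-+ c (f x) _))

ΣL-*ʳ : ∀ (xs : List A) c f → ∑[ x ∈ xs ] (f x * c) ≡ ΣL xs f * c
ΣL-*ʳ xs c f = trans (ΣL-cong xs (λ x → ℤP.*-comm (f x) c)) (trans (ΣL-*ˡ xs c f) (ℤP.*-comm c _))

ΣL-comm : ∀ (xs : List A) (ys : List B) (f : A → B → ℤ) →
  ∑[ x ∈ xs ] ∑[ y ∈ ys ] f x y ≡ ∑[ y ∈ ys ] ∑[ x ∈ xs ] f x y
ΣL-comm []       ys f = sym (ΣL-zero ys)
ΣL-comm (x ∷ xs) ys f = trans (cong (_+_ (ΣL ys (f x))) (ΣL-comm xs ys f)) (sym (ΣL-distrib-+ ys (f x) _))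

ΣL-length : ∀ (xs : List A) → + length xs ≡ ∑[ _ ∈ xs ] 1ℤ
ΣL-length []       = refl
ΣL-length (x ∷ xs) = trans (ℤP.pos-+ 1 (length xs)) (cong (_+_ 1ℤ) (ΣL-length xs))

ΣL-filterᵇ : ∀ (p : A → Bool) xs f → ΣL (filterᵇ p xs) f ≡ ∑[ x ∈ xs ] (𝟙 (p x) * f x)
ΣL-filterᵇ p []       f = refl
ΣL-filterᵇ p (x ∷ xs) f with p x
... | true  = cong₂ _+_ (sym (ℤP.*-identityˡ (f x))) (ΣL-filterᵇ p xs f)
... | false = trans (ΣL-filterᵇ p xs f) (sym (trans (cong (_+ ∑[ y ∈ xs ] (𝟙 (p y) * f y)) (ℤP.*-zeroˡ (f x))) (ℤP.+-identityˡ _)))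

ΣL-map : ∀ (h : B → A) ys f → ΣL (map h ys) f ≡ ∑[ y ∈ ys ] f (h y)
ΣL-map h []       f = refl
ΣL-map h (y ∷ ys) f = cong (_+_ (f (h y))) (ΣL-map h ys f)

ΣL-concatMap : ∀ (h : B → List A) ys f → ΣL (concatMap h ys) f ≡ ∑[ y ∈ ys ] ΣL (h y) f
ΣL-concatMap h []       f = refl
ΣL-concatMap h (y ∷ ys) f = trans (ΣL-++ (h y) _ f) (cong (_+_ (ΣL (h y) f)) (ΣL-concatMap h ys f))

ΣL-cartesianProduct : ∀ (xs : List A) (ys : List B) f →
  ΣL (cartesianProduct xs ys) f ≡ ∑[ x ∈ xs ] ∑[ y ∈ ys ] f (x , y)
ΣL-cartesianProduct []       ys f = refl
ΣL-cartesianProduct (x ∷ xs) ys f =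
  trans (ΣL-++ (map (x ,_) ys) _ f) (cong₂ _+_ (ΣL-map (x ,_) ys f) (ΣL-cartesianProduct xs ys f))

ΣL-tabulate : ∀ n (g : Fin n → A) f → ΣL (tabulate g) f ≡ ∑[ i < n ] f (g i)
ΣL-tabulate zero    g f = refl
ΣL-tabulate (suc n) g f = cong (_+_ (f (g fzero))) (ΣL-tabulate n (λ i → g (fsuc i)) f)

ΣL-allFin : ∀ n (f : Fin n → ℤ) → ΣL (allFin n) f ≡ sum f
ΣL-allFin n = ΣL-tabulate n (λ i → i)

∑-const : ∀ n c → ∑[ _ < n ] c ≡ + n * c
∑-const zero    c = refl
∑-const (suc n) c = trans (cong (_+_ c) (∑-const n c)) (distrib c (+ n))
  where
  distrib : ∀ c m → c + m * c ≡ (1ℤ + m) * c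
  distrib = solve-∀

∑-*ˡ : ∀ {n} c (f : Fin n → ℤ) → ∑[ i < n ] (c * f i) ≡ c * sum f
∑-*ˡ c f = sym (*-distribˡ-sum c f)

∑-*ʳ : ∀ {n} c (f : Fin n → ℤ) → ∑[ i < n ] (f i * c) ≡ sum f * c
∑-*ʳ c f = sym (*-distribʳ-sum c f)

∑-distrib-- : ∀ {n} (f g : Fin n → ℤ) → ∑[ i < n ] (f i - g i) ≡ sum f - sum g
∑-distrib-- f g = trans (∑-distrib-+ f (λ i → - g i))
  (cong (_+_ (sum f)) (trans (sum-cong-≗ (λ i → sym (ℤP.-1*i≡-i (g i)))) (trans (∑-*ˡ -1ℤ g) (ℤP.-1*i≡-i (sum g)))))

module _ {n : ℕ} where
  δ : Fin n → Fin n → ℤ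
  δ = δ[ _≟F_ ]

  δ≢ : Fin n → Fin n → ℤ
  δ≢ a b = 1ℤ - δ a b

  δ-refl : ∀ a → δ a a ≡ 1ℤ
  δ-refl a = cong 𝟙 (dec-true (a ≟F a) refl)

  δ-≢ : ∀ {a b} → ¬ a ≡ b → δ a b ≡ 0ℤ
  δ-≢ {a} {b} a≢b = cong 𝟙 (dec-false (a ≟F b) a≢b)

  𝟙-≢ : ∀ a b → 𝟙 (not ⌊ a ≟F b ⌋) ≡ δ≢ a b
  𝟙-≢ a b = trans (cong (λ p → 𝟙 (not p)) (isYes≗does (a ≟F b))) (𝟙-not (does (a ≟F b)))

  δ≢-guard : ∀ a b {x y : ℤ} → (¬ a ≡ b → x ≡ y) → δ≢ a b * x ≡ δ≢ a b * y
  δ≢-guard a b {x} {y} h with a ≟F b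
  ... | yes refl = trans (ℤP.*-zeroˡ x) (sym (ℤP.*-zeroˡ y))
  ... | no a≢b  = cong (1ℤ *_) (h a≢b)

∑-δ : ∀ {n} (a : Fin n) (f : Fin n → ℤ) → ∑[ b < n ] (δ a b * f b) ≡ f a
∑-δ {suc n} fzero    f = trans (cong₂ _+_ (ℤP.*-identityˡ (f fzero)) (sum-replicate-zero n)) (ℤP.+-identityʳ _)
∑-δ {suc n} (fsuc a) f = begin
  0ℤ * f fzero + ∑[ i < n ] (δ a i * f (fsuc i)) ≡⟨ cong (_+ ∑[ i < n ] (δ a i * f (fsuc i))) (ℤP.*-zeroˡ (f fzero)) ⟩
  0ℤ + ∑[ i < n ] (δ a i * f (fsuc i))           ≡⟨ ℤP.+-identityˡ _ ⟩
  ∑[ i < n ] (δ a i * f (fsuc i))                ≡⟨ ∑-δ a (λ i → f (fsuc i)) ⟩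
  f (fsuc a)                                     ∎

δ-sym : ∀ {n} (a b : Fin n) → δ a b ≡ δ b a
δ-sym fzero    fzero    = refl
δ-sym fzero    (fsuc b) = refl
δ-sym (fsuc a) fzero    = refl
δ-sym (fsuc a) (fsuc b) = δ-sym a b

∑-δʳ : ∀ {n} (a : Fin n) (f : Fin n → ℤ) → ∑[ b < n ] (δ b a * f b) ≡ f a
∑-δʳ a f = trans (sum-cong-≗ (λ b → cong (_* f b) (δ-sym b a))) (∑-δ a f)

∑-δ-one : ∀ {n} (a : Fin n) → ∑[ b < n ] δ b a ≡ 1ℤ
∑-δ-one a = trans (sum-cong-≗ (λ b → sym (ℤP.*-identityʳ (δ b a)))) (∑-δʳ a (λ _ → 1ℤ))

∑-δ≢ : ∀ {n} (a : Fin n) (f : Fin n → ℤ) → ∑[ b < n ] (δ≢ a b * f b) ≡ sum f - f a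
∑-δ≢ {n} a f = begin
  ∑[ b < n ] (δ≢ a b * f b)          ≡⟨ sum-cong-≗ (λ b → expand (δ a b) (f b)) ⟩
  ∑[ b < n ] (f b - δ a b * f b)     ≡⟨ ∑-distrib-- f _ ⟩
  sum f - ∑[ b < n ] (δ a b * f b)   ≡⟨ cong (_-_ (sum f)) (∑-δ a f) ⟩
  sum f - f a                        ∎
  where
  expand : ∀ p q → (1ℤ - p) * q ≡ q - p * q
  expand = solve-∀

∑-δ≢-δ≢ : ∀ {n} (a b : Fin n) (f : Fin n → ℤ) →
  ∑[ z < n ] (δ≢ a z * (δ≢ b z * f z)) ≡ sum f - f a - f b + δ b a * f a
∑-δ≢-δ≢ {n} a b f = begin
  ∑[ z < n ] (δ≢ a z * (δ≢ b z * f z))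
    ≡⟨ sum-cong-≗ (λ z → expand (δ a z) (δ b z) (f z)) ⟩
  ∑[ z < n ] (f z - δ a z * f z - δ b z * f z + δ a z * (δ b z * f z))
    ≡⟨ ∑-distrib-+ (λ z → f z - δ a z * f z - δ b z * f z) (λ z → δ a z * (δ b z * f z)) ⟩
  ∑[ z < n ] (f z - δ a z * f z - δ b z * f z) + ∑[ z < n ] (δ a z * (δ b z * f z))
    ≡⟨ cong (_+ ∑[ z < n ] (δ a z * (δ b z * f z))) (trans (∑-distrib-- (λ z → f z - δ a z * f z) (λ z → δ b z * f z))
         (cong (_- ∑[ z < n ] (δ b z * f z)) (∑-distrib-- f (λ z → δ a z * f z)))) ⟩
  sum f - ∑[ z < n ] (δ a z * f z) - ∑[ z < n ] (δ b z * f z) + ∑[ z < n ] (δ a z * (δ b z * f z))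
    ≡⟨ cong₂ _+_ (cong₂ _-_ (cong (_-_ (sum f)) (∑-δ a f)) (∑-δ b f)) (∑-δ a (λ z → δ b z * f z)) ⟩
  sum f - f a - f b + δ b a * f a
    ∎
  where
  expand : ∀ p q r → (1ℤ - p) * ((1ℤ - q) * r) ≡ r - p * r - q * r + p * (q * r)
  expand = solve-∀

∑-affine : ∀ {n} K R (c : Fin n) → ∑[ z < n ] (K + R * δ z c) ≡ + n * K + R
∑-affine {n} K R c = trans (∑-distrib-+ (λ _ → K) (λ z → R * δ z c))
  (cong₂ _+_ (∑-const n K) (trans (∑-*ˡ R (λ z → δ z c)) (trans (cong (R *_) (∑-δ-one c)) (ℤP.*-identityʳ R))))

∑-δ-quadratic : ∀ {n} a₀ a₁ a₂ a₃ (c y : Fin n) →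
  ∑[ z < n ] (a₀ + a₁ * δ z c + a₂ * δ z y + a₃ * (δ z y * δ z c)) ≡ + n * a₀ + a₁ + a₂ + a₃ * δ y c
∑-δ-quadratic {n} a₀ a₁ a₂ a₃ c y = begin
  ∑[ z < n ] (a₀ + a₁ * δ z c + a₂ * δ z y + a₃ * (δ z y * δ z c))
    ≡⟨ ∑-distrib-+ (λ z → a₀ + a₁ * δ z c + a₂ * δ z y) (λ z → a₃ * (δ z y * δ z c)) ⟩
  ∑[ z < n ] (a₀ + a₁ * δ z c + a₂ * δ z y) + ∑[ z < n ] (a₃ * (δ z y * δ z c))
    ≡⟨ cong (_+ ∑[ z < n ] (a₃ * (δ z y * δ z c))) (trans (∑-distrib-+ (λ z → a₀ + a₁ * δ z c) (λ z → a₂ * δ z y))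
         (cong (_+ ∑[ z < n ] (a₂ * δ z y)) (∑-distrib-+ (λ _ → a₀) (λ z → a₁ * δ z c)))) ⟩
  ∑[ _ < n ] a₀ + ∑[ z < n ] (a₁ * δ z c) + ∑[ z < n ] (a₂ * δ z y) + ∑[ z < n ] (a₃ * (δ z y * δ z c))
    ≡⟨ cong₂ _+_ (cong₂ _+_ (cong₂ _+_ (∑-const n a₀) (single a₁ c)) (single a₂ y))
                 (trans (∑-*ˡ a₃ (λ z → δ z y * δ z c)) (cong (a₃ *_) (∑-δʳ y (λ z → δ z c)))) ⟩
  + n * a₀ + a₁ + a₂ + a₃ * δ y c
    ∎
  where
  single : ∀ a e → ∑[ z < n ] (a * δ z e) ≡ a
  single a e = trans (∑-*ˡ a (λ z → δ z e)) (trans (cong (a *_) (∑-δ-one e)) (ℤP.*-identityʳ a))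

arcℤ : (H : Digraph) → V H → V H → ℤ
arcℤ H x y = 𝟙 (arc H x y)

δᵥ : (H : Digraph) → V H → V H → ℤ
δᵥ H = δ[ _≟V_ H ]

-- Duplicate-freeness of the vertex list, in the form of collapsing Kronecker-delta sums.
VertsUnique : Digraph → Set
VertsUnique H = ∀ (F : V H → V H → ℤ) →
  ∑[ x ∈ verts H ] ∑[ y ∈ verts H ] (δᵥ H x y * F x y) ≡ ∑[ x ∈ verts H ] F x x

walks : (H : Digraph) → ℕ → V H → ℤ
walks H zero    x = 1ℤ
walks H (suc t) x = ∑[ y ∈ verts H ] (arcℤ H x y * walks H t y)

ΣL-verts-L : ∀ H (g : V H × V H → ℤ) →
  ΣL (verts (L H)) g ≡ ∑[ u ∈ verts H ] ∑[ v ∈ verts H ] (arcℤ H u v * g (u , v))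
ΣL-verts-L H g = trans (ΣL-filterᵇ _ (cartesianProduct (verts H) (verts H)) g) (ΣL-cartesianProduct (verts H) (verts H) _)

δᵥ-L : ∀ H (a b c e : V H) → δᵥ (L H) (a , b) (c , e) ≡ δᵥ H a c * δᵥ H b e
δᵥ-L H a b c e = trans
  (cong 𝟙 (does-≡ (_≟V_ (L H) (a , b) (c , e))
    (map′ (λ { (refl , refl) → refl }) (λ { refl → refl , refl }) (_≟V_ H a c ×-dec _≟V_ H b e))))
  (𝟙-∧ (does (_≟V_ H a c)) (does (_≟V_ H b e)))

arcℤ-L : ∀ H (a b c e : V H) → arcℤ (L H) (a , b) (c , e) ≡ δᵥ H b c
arcℤ-L H a b c e = cong 𝟙 (isYes≗does (_≟V_ H b c))

Lⁿ-L : ∀ t H → Lⁿ t (L H) ≡ L (Lⁿ t H)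
Lⁿ-L zero    H = refl
Lⁿ-L (suc t) H = cong L (Lⁿ-L t H)

ΣL-swap-pairs : ∀ (xs : List A) (f : A → A → A → A → ℤ) →
  ∑[ u ∈ xs ] ∑[ v ∈ xs ] ∑[ u′ ∈ xs ] ∑[ w ∈ xs ] f u v u′ w
  ≡ ∑[ u′ ∈ xs ] ∑[ w ∈ xs ] ∑[ u ∈ xs ] ∑[ v ∈ xs ] f u v u′ w
ΣL-swap-pairs xs f = begin
  ∑[ u ∈ xs ] ∑[ v ∈ xs ] ∑[ u′ ∈ xs ] ∑[ w ∈ xs ] f u v u′ w ≡⟨ ΣL-cong xs (λ u → ΣL-comm xs xs _) ⟩
  ∑[ u ∈ xs ] ∑[ u′ ∈ xs ] ∑[ v ∈ xs ] ∑[ w ∈ xs ] f u v u′ w ≡⟨ ΣL-cong xs (λ u → ΣL-cong xs (λ u′ → ΣL-comm xs xs _)) ⟩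
  ∑[ u ∈ xs ] ∑[ u′ ∈ xs ] ∑[ w ∈ xs ] ∑[ v ∈ xs ] f u v u′ w ≡⟨ ΣL-comm xs xs _ ⟩
  ∑[ u′ ∈ xs ] ∑[ u ∈ xs ] ∑[ w ∈ xs ] ∑[ v ∈ xs ] f u v u′ w ≡⟨ ΣL-cong xs (λ u′ → ΣL-comm xs xs _) ⟩
  ∑[ u′ ∈ xs ] ∑[ w ∈ xs ] ∑[ u ∈ xs ] ∑[ v ∈ xs ] f u v u′ w ∎

VertsUnique-L : ∀ H → VertsUnique H → VertsUnique (L H)
VertsUnique-L H unique F = begin
  ∑[ p ∈ verts (L H) ] ∑[ p′ ∈ verts (L H) ] (δᵥ (L H) p p′ * F p p′)
    ≡⟨ ΣL-verts-L H _ ⟩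
  ∑[ u ∈ vs ] ∑[ v ∈ vs ] (arcℤ H u v * ∑[ p′ ∈ verts (L H) ] (δᵥ (L H) (u , v) p′ * F (u , v) p′))
    ≡⟨ ΣL-cong vs (λ u → ΣL-cong vs (λ v → cong (arcℤ H u v *_) (ΣL-verts-L H _))) ⟩
  ∑[ u ∈ vs ] ∑[ v ∈ vs ] (arcℤ H u v *
    ∑[ u′ ∈ vs ] ∑[ v′ ∈ vs ] (arcℤ H u′ v′ * (δᵥ (L H) (u , v) (u′ , v′) * F (u , v) (u′ , v′))))
    ≡⟨ ΣL-cong vs (λ u → ΣL-cong vs (λ v → factor u v)) ⟩
  ∑[ u ∈ vs ] ∑[ v ∈ vs ] ∑[ u′ ∈ vs ] (δᵥ H u u′ * ∑[ v′ ∈ vs ] (δᵥ H v v′ * K u v u′ v′))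
    ≡⟨ ΣL-cong vs (λ u → ΣL-comm vs vs _) ⟩
  ∑[ u ∈ vs ] ∑[ u′ ∈ vs ] ∑[ v ∈ vs ] (δᵥ H u u′ * ∑[ v′ ∈ vs ] (δᵥ H v v′ * K u v u′ v′))
    ≡⟨ ΣL-cong vs (λ u → ΣL-cong vs (λ u′ → ΣL-*ˡ vs (δᵥ H u u′) _)) ⟩
  ∑[ u ∈ vs ] ∑[ u′ ∈ vs ] (δᵥ H u u′ * ∑[ v ∈ vs ] ∑[ v′ ∈ vs ] (δᵥ H v v′ * K u v u′ v′))
    ≡⟨ ΣL-cong vs (λ u → ΣL-cong vs (λ u′ → cong (δᵥ H u u′ *_) (unique (λ v v′ → K u v u′ v′)))) ⟩
  ∑[ u ∈ vs ] ∑[ u′ ∈ vs ] (δᵥ H u u′ * ∑[ v ∈ vs ] K u v u′ v)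
    ≡⟨ unique (λ u u′ → ∑[ v ∈ vs ] K u v u′ v) ⟩
  ∑[ u ∈ vs ] ∑[ v ∈ vs ] K u v u v
    ≡⟨ ΣL-cong vs (λ u → ΣL-cong vs (λ v → cong (_* F (u , v) (u , v)) (𝟙-idem (arc H u v)))) ⟩
  ∑[ u ∈ vs ] ∑[ v ∈ vs ] (arcℤ H u v * F (u , v) (u , v))
    ≡⟨ ΣL-verts-L H (λ p → F p p) ⟨
  ∑[ p ∈ verts (L H) ] F p p
    ∎
  where
  vs = verts H
  K : V H → V H → V H → V H → ℤ
  K u v u′ v′ = arcℤ H u v * arcℤ H u′ v′ * F (u , v) (u′ , v′)
  factor : ∀ u v →
    arcℤ H u v * ∑[ u′ ∈ vs ] ∑[ v′ ∈ vs ] (arcℤ H u′ v′ * (δᵥ (L H) (u , v) (u′ , v′) * F (u , v) (u′ , v′)))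
    ≡ ∑[ u′ ∈ vs ] (δᵥ H u u′ * ∑[ v′ ∈ vs ] (δᵥ H v v′ * K u v u′ v′))
  factor u v = begin
    arcℤ H u v * ∑[ u′ ∈ vs ] ∑[ v′ ∈ vs ] (arcℤ H u′ v′ * (δᵥ (L H) (u , v) (u′ , v′) * F (u , v) (u′ , v′)))
      ≡⟨ ΣL-*ˡ vs (arcℤ H u v) _ ⟨
    ∑[ u′ ∈ vs ] (arcℤ H u v * ∑[ v′ ∈ vs ] (arcℤ H u′ v′ * (δᵥ (L H) (u , v) (u′ , v′) * F (u , v) (u′ , v′))))
      ≡⟨ ΣL-cong vs (λ u′ → trans (sym (ΣL-*ˡ vs (arcℤ H u v) _))
           (trans (ΣL-cong vs (λ v′ → pointwise u′ v′)) (ΣL-*ˡ vs (δᵥ H u u′) _))) ⟩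
    ∑[ u′ ∈ vs ] (δᵥ H u u′ * ∑[ v′ ∈ vs ] (δᵥ H v v′ * K u v u′ v′))
      ∎
    where
    pointwise : ∀ u′ v′ → arcℤ H u v * (arcℤ H u′ v′ * (δᵥ (L H) (u , v) (u′ , v′) * F (u , v) (u′ , v′)))
                        ≡ δᵥ H u u′ * (δᵥ H v v′ * K u v u′ v′)
    pointwise u′ v′ =
      trans (cong (λ z → arcℤ H u v * (arcℤ H u′ v′ * (z * F (u , v) (u′ , v′)))) (δᵥ-L H u v u′ v′))
            (reorder (arcℤ H u v) (arcℤ H u′ v′) (δᵥ H u u′) (δᵥ H v v′) (F (u , v) (u′ , v′)))
      where
      reorder : ∀ a b c d f → a * (b * (c * d * f)) ≡ c * (d * (a * b * f))
      reorder = solve-∀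

walks-L : ∀ t H → VertsUnique H → ∀ (h : V H → V H → ℤ) →
  ∑[ u ∈ verts H ] ∑[ v ∈ verts H ] (h u v * walks (L H) t (u , v))
  ≡ ∑[ u ∈ verts H ] ∑[ v ∈ verts H ] (h u v * walks H t v)
walks-L zero    H unique h = refl
walks-L (suc t) H unique h = begin
  ∑[ u ∈ vs ] ∑[ v ∈ vs ] (h u v * walks (L H) (suc t) (u , v))
    ≡⟨ ΣL-cong vs (λ u → ΣL-cong vs (λ v → unfold u v)) ⟩
  ∑[ u ∈ vs ] ∑[ v ∈ vs ] ∑[ u′ ∈ vs ] ∑[ w ∈ vs ] (Y u v u′ w * walks (L H) t (u′ , w))
    ≡⟨ ΣL-swap-pairs vs _ ⟩
  ∑[ u′ ∈ vs ] ∑[ w ∈ vs ] ∑[ u ∈ vs ] ∑[ v ∈ vs ] (Y u v u′ w * walks (L H) t (u′ , w))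
    ≡⟨ ΣL-cong vs (λ u′ → ΣL-cong vs (λ w → collect u′ w (walks (L H) t (u′ , w)))) ⟩
  ∑[ u′ ∈ vs ] ∑[ w ∈ vs ] (h′ u′ w * walks (L H) t (u′ , w))
    ≡⟨ walks-L t H unique h′ ⟩
  ∑[ u′ ∈ vs ] ∑[ w ∈ vs ] (h′ u′ w * walks H t w)
    ≡⟨ ΣL-cong vs (λ u′ → ΣL-cong vs (λ w → collect u′ w (walks H t w))) ⟨
  ∑[ u′ ∈ vs ] ∑[ w ∈ vs ] ∑[ u ∈ vs ] ∑[ v ∈ vs ] (Y u v u′ w * walks H t w)
    ≡⟨ ΣL-swap-pairs vs _ ⟨
  ∑[ u ∈ vs ] ∑[ v ∈ vs ] ∑[ u′ ∈ vs ] ∑[ w ∈ vs ] (Y u v u′ w * walks H t w)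
    ≡⟨ ΣL-cong vs (λ u → ΣL-cong vs (λ v → refold u v)) ⟩
  ∑[ u ∈ vs ] ∑[ v ∈ vs ] ∑[ u′ ∈ vs ] (δᵥ H v u′ * (h u v * walks H (suc t) u′))
    ≡⟨ ΣL-cong vs (λ u → unique (λ v u′ → h u v * walks H (suc t) u′)) ⟩
  ∑[ u ∈ vs ] ∑[ v ∈ vs ] (h u v * walks H (suc t) v)
    ∎
  where
  vs = verts H
  Y : V H → V H → V H → V H → ℤ
  Y u v u′ w = h u v * δᵥ H v u′ * arcℤ H u′ w
  h′ : V H → V H → ℤ
  h′ u′ w = ∑[ u ∈ vs ] ∑[ v ∈ vs ] Y u v u′ w
  collect : ∀ u′ w (c : ℤ) → ∑[ u ∈ vs ] ∑[ v ∈ vs ] (Y u v u′ w * c) ≡ h′ u′ w * c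
  collect u′ w c = trans (ΣL-cong vs (λ u → ΣL-*ʳ vs c (λ v → Y u v u′ w))) (ΣL-*ʳ vs c (λ u → ∑[ v ∈ vs ] Y u v u′ w))
  unfold : ∀ u v → h u v * walks (L H) (suc t) (u , v)
                 ≡ ∑[ u′ ∈ vs ] ∑[ w ∈ vs ] (Y u v u′ w * walks (L H) t (u′ , w))
  unfold u v = begin
    h u v * walks (L H) (suc t) (u , v)
      ≡⟨ cong (h u v *_) (ΣL-verts-L H _) ⟩
    h u v * ∑[ u′ ∈ vs ] ∑[ w ∈ vs ] (arcℤ H u′ w * (arcℤ (L H) (u , v) (u′ , w) * walks (L H) t (u′ , w)))
      ≡⟨ ΣL-*ˡ vs (h u v) _ ⟨
    ∑[ u′ ∈ vs ] (h u v * ∑[ w ∈ vs ] (arcℤ H u′ w * (arcℤ (L H) (u , v) (u′ , w) * walks (L H) t (u′ , w))))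
      ≡⟨ ΣL-cong vs (λ u′ → trans (sym (ΣL-*ˡ vs (h u v) _)) (ΣL-cong vs (λ w → pointwise u′ w))) ⟩
    ∑[ u′ ∈ vs ] ∑[ w ∈ vs ] (Y u v u′ w * walks (L H) t (u′ , w))
      ∎
    where
    pointwise : ∀ u′ w → h u v * (arcℤ H u′ w * (arcℤ (L H) (u , v) (u′ , w) * walks (L H) t (u′ , w)))
                       ≡ Y u v u′ w * walks (L H) t (u′ , w)
    pointwise u′ w = trans (cong (λ z → h u v * (arcℤ H u′ w * (z * walks (L H) t (u′ , w)))) (arcℤ-L H u v u′ w))
                           (reorder (h u v) (arcℤ H u′ w) (δᵥ H v u′) (walks (L H) t (u′ , w)))
      where
      reorder : ∀ a b c d → a * (b * (c * d)) ≡ a * c * b * d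
      reorder = solve-∀
  refold : ∀ u v → ∑[ u′ ∈ vs ] ∑[ w ∈ vs ] (Y u v u′ w * walks H t w)
                 ≡ ∑[ u′ ∈ vs ] (δᵥ H v u′ * (h u v * walks H (suc t) u′))
  refold u v = ΣL-cong vs (λ u′ →
    trans (ΣL-cong vs (λ w → reorder (h u v) (δᵥ H v u′) (arcℤ H u′ w) (walks H t w)))
          (trans (ΣL-*ˡ vs (δᵥ H v u′ * h u v) (λ w → arcℤ H u′ w * walks H t w)) (ℤP.*-assoc (δᵥ H v u′) (h u v) _)))
    where
    reorder : ∀ a b c d → a * b * c * d ≡ b * a * (c * d)
    reorder = solve-∀

order-Lⁿ : ∀ t H → VertsUnique H → + order (Lⁿ t H) ≡ ∑[ x ∈ verts H ] walks H t x
order-Lⁿ zero    H unique = ΣL-length (verts H)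
order-Lⁿ (suc t) H unique = begin
  + order (L (Lⁿ t H))                                              ≡⟨ cong (λ G → + order G) (Lⁿ-L t H) ⟨
  + order (Lⁿ t (L H))                                              ≡⟨ order-Lⁿ t (L H) (VertsUnique-L H unique) ⟩
  ∑[ p ∈ verts (L H) ] walks (L H) t p                              ≡⟨ ΣL-verts-L H _ ⟩
  ∑[ u ∈ verts H ] ∑[ v ∈ verts H ] (arcℤ H u v * walks (L H) t (u , v)) ≡⟨ walks-L t H unique (arcℤ H) ⟩
  ∑[ x ∈ verts H ] walks H (suc t) x                                ∎

module _ {n : ℕ} where
  ΣVec : (k : ℕ) → (Vec (Fin n) k → ℤ) → ℤ
  ΣVec zero    f = f []
  ΣVec (suc k) f = ∑[ a < n ] ΣVec k (λ w → f (a ∷ w))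

  infixl 10 ΣVec
  syntax ΣVec k (λ w → e) = ∑[ w ∈Vec k ] e

  ΣL-allWords : ∀ k f → ΣL (allWords n k) f ≡ ΣVec k f
  ΣL-allWords zero    f = ℤP.+-identityʳ (f [])
  ΣL-allWords (suc k) f = begin
    ΣL (concatMap (λ a → map (a ∷_) (allWords n k)) (allFin n)) f
      ≡⟨ ΣL-concatMap _ (allFin n) f ⟩
    ∑[ a ∈ allFin n ] ΣL (map (a ∷_) (allWords n k)) f
      ≡⟨ ΣL-allFin n _ ⟩
    ∑[ a < n ] ΣL (map (a ∷_) (allWords n k)) f
      ≡⟨ sum-cong-≗ (λ a → trans (ΣL-map (a ∷_) (allWords n k) f) (ΣL-allWords k (λ w → f (a ∷ w)))) ⟩
    ΣVec (suc k) f
      ∎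

  ΣVec-cong : ∀ k {f g : Vec (Fin n) k → ℤ} → (∀ w → f w ≡ g w) → ΣVec k f ≡ ΣVec k g
  ΣVec-cong zero    f≗g = f≗g []
  ΣVec-cong (suc k) f≗g = sum-cong-≗ (λ a → ΣVec-cong k (λ w → f≗g (a ∷ w)))

  ΣVec-*ˡ : ∀ k c (f : Vec (Fin n) k → ℤ) → ∑[ w ∈Vec k ] (c * f w) ≡ c * ΣVec k f
  ΣVec-*ˡ zero    c f = refl
  ΣVec-*ˡ (suc k) c f = trans (sum-cong-≗ (λ a → ΣVec-*ˡ k c (λ w → f (a ∷ w)))) (∑-*ˡ c (λ a → ΣVec k (λ w → f (a ∷ w))))

  ΣVec-*ʳ : ∀ k c (f : Vec (Fin n) k → ℤ) → ∑[ w ∈Vec k ] (f w * c) ≡ ΣVec k f * c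
  ΣVec-*ʳ zero    c f = refl
  ΣVec-*ʳ (suc k) c f = trans (sum-cong-≗ (λ a → ΣVec-*ʳ k c (λ w → f (a ∷ w)))) (∑-*ʳ c (λ a → ΣVec k (λ w → f (a ∷ w))))

  ΣVec-∑-comm : ∀ k (f : Vec (Fin n) k → Fin n → ℤ) → ∑[ w ∈Vec k ] ∑[ a < n ] f w a ≡ ∑[ a < n ] ∑[ w ∈Vec k ] f w a
  ΣVec-∑-comm zero    f = refl
  ΣVec-∑-comm (suc k) f =
    trans (sum-cong-≗ (λ b → ΣVec-∑-comm k (λ w → f (b ∷ w)))) (∑-comm (λ b a → ΣVec k (λ w → f (b ∷ w) a)))

  ΣVec-++ : ∀ k l (f : Vec (Fin n) (k ℕ+ l) → ℤ) → ΣVec (k ℕ+ l) f ≡ ∑[ xs ∈Vec k ] ∑[ s ∈Vec l ] f (xs ++ s)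
  ΣVec-++ zero    l f = refl
  ΣVec-++ (suc k) l f = sum-cong-≗ (λ a → ΣVec-++ k l (λ w → f (a ∷ w)))

  δᵛ : ∀ {k} → Vec (Fin n) k → Vec (Fin n) k → ℤ
  δᵛ = δ[ ≡-dec _≟F_ ]

  ΣVec-δ : ∀ k (x : Vec (Fin n) k) (f : Vec (Fin n) k → ℤ) → ∑[ y ∈Vec k ] (δᵛ x y * f y) ≡ f x
  ΣVec-δ zero    []      f = ℤP.*-identityˡ (f [])
  ΣVec-δ (suc k) (a ∷ x) f = begin
    ∑[ b < n ] ∑[ y ∈Vec k ] (δᵛ (a ∷ x) (b ∷ y) * f (b ∷ y))
      ≡⟨ sum-cong-≗ (λ b → ΣVec-cong k (λ y →
           trans (cong (_* f (b ∷ y)) (𝟙-∧ (does (a ≟F b)) _)) (ℤP.*-assoc (δ a b) (δᵛ x y) _))) ⟩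
    ∑[ b < n ] ∑[ y ∈Vec k ] (δ a b * (δᵛ x y * f (b ∷ y)))
      ≡⟨ sum-cong-≗ (λ b → trans (ΣVec-*ˡ k (δ a b) _) (cong (δ a b *_) (ΣVec-δ k x (λ y → f (b ∷ y))))) ⟩
    ∑[ b < n ] (δ a b * f (b ∷ x))
      ≡⟨ ∑-δ a (λ b → f (b ∷ x)) ⟩
    f (a ∷ x)
      ∎

  ΣVec-δ-init : ∀ k (w : Vec (Fin n) k) (f : Vec (Fin n) (suc k) → ℤ) →
    ∑[ v ∈Vec suc k ] (δᵛ w (init v) * f v) ≡ ∑[ a < n ] f (w ∷ʳ a)
  ΣVec-δ-init zero    []      f = sum-cong-≗ (λ a → ℤP.*-identityˡ (f (a ∷ [])))
  ΣVec-δ-init (suc k) (c ∷ w) f = begin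
    ∑[ b < n ] ∑[ v ∈Vec suc k ] (δᵛ (c ∷ w) (b ∷ init v) * f (b ∷ v))
      ≡⟨ sum-cong-≗ (λ b → ΣVec-cong (suc k) (λ v →
           trans (cong (_* f (b ∷ v)) (𝟙-∧ (does (c ≟F b)) (does (≡-dec _≟F_ w (init v)))))
                 (ℤP.*-assoc (δ c b) (δᵛ w (init v)) (f (b ∷ v))))) ⟩
    ∑[ b < n ] ∑[ v ∈Vec suc k ] (δ c b * (δᵛ w (init v) * f (b ∷ v)))
      ≡⟨ sum-cong-≗ (λ b → trans (ΣVec-*ˡ (suc k) (δ c b) (λ v → δᵛ w (init v) * f (b ∷ v)))
                                  (cong (δ c b *_) (ΣVec-δ-init k w (λ v → f (b ∷ v))))) ⟩
    ∑[ b < n ] (δ c b * ∑[ a < n ] f (b ∷ (w ∷ʳ a)))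
      ≡⟨ ∑-δ c (λ b → ∑[ a < n ] f (b ∷ (w ∷ʳ a))) ⟩
    ∑[ a < n ] f (c ∷ (w ∷ʳ a))
      ∎

module _ (d m : ℕ) where
  private
    words = allWords (suc d) (suc m)

  VertsUnique-CK : VertsUnique (CK d (suc m))
  VertsUnique-CK F = begin
    ∑[ x ∈ vs ] ∑[ y ∈ vs ] (δᵛ x y * F x y)
      ≡⟨ ΣL-filterᵇ isCKWord words _ ⟩
    ∑[ x ∈ words ] (𝟙 (isCKWord x) * ∑[ y ∈ vs ] (δᵛ x y * F x y))
      ≡⟨ ΣL-cong words (λ x → cong (𝟙 (isCKWord x) *_) (collapse x)) ⟩
    ∑[ x ∈ words ] (𝟙 (isCKWord x) * (𝟙 (isCKWord x) * F x x))
      ≡⟨ ΣL-cong words (λ x → trans (sym (ℤP.*-assoc (𝟙 (isCKWord x)) _ _)) (cong (_* F x x) (𝟙-idem (isCKWord x)))) ⟩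
    ∑[ x ∈ words ] (𝟙 (isCKWord x) * F x x)
      ≡⟨ ΣL-filterᵇ isCKWord words _ ⟨
    ∑[ x ∈ vs ] F x x
      ∎
    where
    vs = filterᵇ isCKWord words
    swap : ∀ a b c → a * (b * c) ≡ b * (a * c)
    swap = solve-∀
    collapse : ∀ x → ∑[ y ∈ vs ] (δᵛ x y * F x y) ≡ 𝟙 (isCKWord x) * F x x
    collapse x = begin
      ∑[ y ∈ vs ] (δᵛ x y * F x y)                           ≡⟨ ΣL-filterᵇ isCKWord words _ ⟩
      ∑[ y ∈ words ] (𝟙 (isCKWord y) * (δᵛ x y * F x y))     ≡⟨ ΣL-allWords (suc m) _ ⟩
      ∑[ y ∈Vec suc m ] (𝟙 (isCKWord y) * (δᵛ x y * F x y))  ≡⟨ ΣVec-cong (suc m) (λ y → swap (𝟙 (isCKWord y)) (δᵛ x y) (F x y)) ⟩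
      ∑[ y ∈Vec suc m ] (δᵛ x y * (𝟙 (isCKWord y) * F x y))  ≡⟨ ΣVec-δ (suc m) x (λ y → 𝟙 (isCKWord y) * F x y) ⟩
      𝟙 (isCKWord x) * F x x                                 ∎

  ckWalks : ℕ → Vec (Fin (suc d)) (suc m) → ℤ
  ckWalks zero    u = 1ℤ
  ckWalks (suc t) u = ∑[ a < suc d ] (𝟙 (isCKWord (tail u ∷ʳ a)) * ckWalks t (tail u ∷ʳ a))

  walks-CK : ∀ t u → walks (CK d (suc m)) t u ≡ ckWalks t u
  walks-CK zero    u = refl
  walks-CK (suc t) u = begin
    ∑[ v ∈ vs ] (arcℤ CKᵈ u v * walks CKᵈ t v)
      ≡⟨ ΣL-filterᵇ isCKWord words _ ⟩
    ∑[ v ∈ words ] (𝟙 (isCKWord v) * (arcℤ CKᵈ u v * walks CKᵈ t v))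
      ≡⟨ ΣL-allWords (suc m) _ ⟩
    ∑[ v ∈Vec suc m ] (𝟙 (isCKWord v) * (arcℤ CKᵈ u v * walks CKᵈ t v))
      ≡⟨ ΣVec-cong (suc m) pointwise ⟩
    ∑[ v ∈Vec suc m ] (δᵛ (tail u) (init v) * (𝟙 (isCKWord v) * ckWalks t v))
      ≡⟨ ΣVec-δ-init m (tail u) (λ v → 𝟙 (isCKWord v) * ckWalks t v) ⟩
    ckWalks (suc t) u
      ∎
    where
    CKᵈ = CK d (suc m)
    vs = filterᵇ isCKWord words
    swap : ∀ a b c → a * (b * c) ≡ b * (a * c)
    swap = solve-∀
    pointwise : ∀ v → 𝟙 (isCKWord v) * (arcℤ CKᵈ u v * walks CKᵈ t v) ≡ δᵛ (tail u) (init v) * (𝟙 (isCKWord v) * ckWalks t v)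
    pointwise v = trans (cong₂ (λ b w → 𝟙 (isCKWord v) * (𝟙 b * w)) (isYes≗does (≡-dec _≟F_ (tail u) (init v))) (walks-CK t v))
                        (swap (𝟙 (isCKWord v)) (δᵛ (tail u) (init v)) (ckWalks t v))

  order-Lⁿ-CK-ckWalks : ∀ t → + order (Lⁿ t (CK d (suc m))) ≡ ∑[ u ∈Vec suc m ] (𝟙 (isCKWord u) * ckWalks t u)
  order-Lⁿ-CK-ckWalks t = begin
    + order (Lⁿ t (CK d (suc m)))                                  ≡⟨ order-Lⁿ t (CK d (suc m)) VertsUnique-CK ⟩
    ∑[ u ∈ filterᵇ isCKWord words ] walks (CK d (suc m)) t u       ≡⟨ ΣL-filterᵇ isCKWord words _ ⟩
    ∑[ u ∈ words ] (𝟙 (isCKWord u) * walks (CK d (suc m)) t u)     ≡⟨ ΣL-allWords (suc m) _ ⟩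
    ∑[ u ∈Vec suc m ] (𝟙 (isCKWord u) * walks (CK d (suc m)) t u)  ≡⟨ ΣVec-cong (suc m) (λ u → cong (𝟙 (isCKWord u) *_) (walks-CK t u)) ⟩
    ∑[ u ∈Vec suc m ] (𝟙 (isCKWord u) * ckWalks t u)              ∎

take-toList-∷ʳ : ∀ {k} t (v : Vec A k) a → t ≤ k → take t (toList (v ∷ʳ a)) ≡ take t (toList v)
take-toList-∷ʳ zero    v       a t≤k       = refl
take-toList-∷ʳ (suc t) (x ∷ v) a (s≤s t≤k) = cong (x ∷_) (take-toList-∷ʳ t v a t≤k)

take-toList-++ : ∀ {k l} (xs : Vec A k) (s : Vec A l) → take k (toList (xs ++ s)) ≡ toList xs
take-toList-++ []       s = refl
take-toList-++ (x ∷ xs) s = cong (x ∷_) (take-toList-++ xs s)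

module _ {n : ℕ} where
  last-++ : ∀ {k l} (x : Fin n) (xs : Vec (Fin n) k) (s : Vec (Fin n) (suc l)) → last (x ∷ (xs ++ s)) ≡ last s
  last-++ x []       (y ∷ s) = refl
  last-++ x (y ∷ xs) s       = last-++ y xs s

  consecDistinct-∷ʳ : ∀ {k} x (v : Vec (Fin n) k) a →
    consecDistinct (x ∷ (v ∷ʳ a)) ≡ consecDistinct (x ∷ v) ∧ not ⌊ last (x ∷ v) ≟F a ⌋
  consecDistinct-∷ʳ x []      a = ∧-identityʳ _
  consecDistinct-∷ʳ x (y ∷ v) a =
    trans (cong (not ⌊ x ≟F y ⌋ ∧_) (consecDistinct-∷ʳ y v a)) (sym (∧-assoc (not ⌊ x ≟F y ⌋) _ _))

  consecDistinct-++ : ∀ {k l} x (xs : Vec (Fin n) k) (s : Vec (Fin n) l) →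
    consecDistinct (x ∷ (xs ++ s)) ≡ consecDistinct (x ∷ xs) ∧ consecDistinct (last (x ∷ xs) ∷ s)
  consecDistinct-++ x []       s = refl
  consecDistinct-++ x (y ∷ xs) s =
    trans (cong (not ⌊ x ≟F y ⌋ ∧_) (consecDistinct-++ y xs s)) (sym (∧-assoc (not ⌊ x ≟F y ⌋) _ _))

  -- avoidingWalks y (x₁ ∷ … ∷ xₖ) counts the walks y = a₀, a₁, …, aₖ in the complete digraph with aᵢ ≠ xᵢ.
  avoidingWalks : Fin n → List (Fin n) → ℤ
  avoidingWalks y []       = 1ℤ
  avoidingWalks y (x ∷ xs) = ∑[ a < n ] (δ≢ y a * (δ≢ x a * avoidingWalks a xs))

module _ {d : ℕ} where
  isCKWord-∷ʳ : ∀ {k} x (v : Vec (Fin (suc d)) k) a →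
    𝟙 (isCKWord (x ∷ (v ∷ʳ a))) ≡ 𝟙 (consecDistinct (x ∷ v)) * δ≢ (last (x ∷ v)) a * δ≢ x a
  isCKWord-∷ʳ x v a = begin
    𝟙 (consecDistinct (x ∷ (v ∷ʳ a)) ∧ not ⌊ x ≟F last (x ∷ (v ∷ʳ a)) ⌋)
      ≡⟨ 𝟙-∧ (consecDistinct (x ∷ (v ∷ʳ a))) _ ⟩
    𝟙 (consecDistinct (x ∷ (v ∷ʳ a))) * 𝟙 (not ⌊ x ≟F last (x ∷ (v ∷ʳ a)) ⌋)
      ≡⟨ cong₂ _*_ (trans (cong 𝟙 (consecDistinct-∷ʳ x v a))
                          (trans (𝟙-∧ (consecDistinct (x ∷ v)) _) (cong (𝟙 (consecDistinct (x ∷ v)) *_) (𝟙-≢ (last (x ∷ v)) a))))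
                   (trans (cong (λ z → 𝟙 (not ⌊ x ≟F z ⌋)) (last-∷ʳ a (x ∷ v))) (𝟙-≢ x a)) ⟩
    𝟙 (consecDistinct (x ∷ v)) * δ≢ (last (x ∷ v)) a * δ≢ x a
      ∎

  isCKWord-++ : ∀ {k l} x (xs : Vec (Fin (suc d)) k) (s : Vec (Fin (suc d)) (suc l)) →
    𝟙 (isCKWord (x ∷ (xs ++ s))) ≡ 𝟙 (consecDistinct (x ∷ xs)) * (𝟙 (consecDistinct (last (x ∷ xs) ∷ s)) * δ≢ x (last s))
  isCKWord-++ x xs s = begin
    𝟙 (consecDistinct (x ∷ (xs ++ s)) ∧ not ⌊ x ≟F last (x ∷ (xs ++ s)) ⌋)
      ≡⟨ 𝟙-∧ (consecDistinct (x ∷ (xs ++ s))) _ ⟩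
    𝟙 (consecDistinct (x ∷ (xs ++ s))) * 𝟙 (not ⌊ x ≟F last (x ∷ (xs ++ s)) ⌋)
      ≡⟨ cong₂ _*_ (trans (cong 𝟙 (consecDistinct-++ x xs s)) (𝟙-∧ (consecDistinct (x ∷ xs)) _))
                   (trans (cong (λ z → 𝟙 (not ⌊ x ≟F z ⌋)) (last-++ x xs s)) (𝟙-≢ x (last s))) ⟩
    𝟙 (consecDistinct (x ∷ xs)) * 𝟙 (consecDistinct (last (x ∷ xs) ∷ s)) * δ≢ x (last s)
      ≡⟨ ℤP.*-assoc (𝟙 (consecDistinct (x ∷ xs))) _ _ ⟩
    𝟙 (consecDistinct (x ∷ xs)) * (𝟙 (consecDistinct (last (x ∷ xs) ∷ s)) * δ≢ x (last s))
      ∎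

-- While t < m, the i-th appended letter must differ from the (i+1)-th letter of u, which is still
-- the first letter of the new word.
ckWalks≡avoidingWalks : ∀ {d m} t (u : Vec (Fin (suc d)) (suc m)) → t < m → consecDistinct u ≡ true →
  ckWalks d m t u ≡ avoidingWalks (last u) (take t (toList (tail u)))
ckWalks≡avoidingWalks zero u t<m proper = refl
ckWalks≡avoidingWalks {d} {suc m} (suc t) (x₀ ∷ x₁ ∷ rest) (s≤s t<m) proper = sum-cong-≗ pointwise
  where
  properTail : consecDistinct (x₁ ∷ rest) ≡ true
  properTail = ∧-conicalʳ _ _ proper
  y = last (x₁ ∷ rest)
  reassoc : ∀ p q r → 1ℤ * p * q * r ≡ p * (q * r)
  reassoc = solve-∀
  pointwise : ∀ a → 𝟙 (isCKWord (x₁ ∷ (rest ∷ʳ a))) * ckWalks d (suc m) t (x₁ ∷ (rest ∷ʳ a))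
                  ≡ δ≢ y a * (δ≢ x₁ a * avoidingWalks a (take t (toList rest)))
  pointwise a = begin
    𝟙 (isCKWord (x₁ ∷ (rest ∷ʳ a))) * ckWalks d (suc m) t (x₁ ∷ (rest ∷ʳ a))
      ≡⟨ cong (_* ckWalks d (suc m) t (x₁ ∷ (rest ∷ʳ a))) (isCKWord-∷ʳ x₁ rest a) ⟩
    𝟙 (consecDistinct (x₁ ∷ rest)) * δ≢ y a * δ≢ x₁ a * ckWalks d (suc m) t (x₁ ∷ (rest ∷ʳ a))
      ≡⟨ cong (λ b → 𝟙 b * δ≢ y a * δ≢ x₁ a * ckWalks d (suc m) t (x₁ ∷ (rest ∷ʳ a))) properTail ⟩
    1ℤ * δ≢ y a * δ≢ x₁ a * ckWalks d (suc m) t (x₁ ∷ (rest ∷ʳ a))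
      ≡⟨ reassoc (δ≢ y a) (δ≢ x₁ a) _ ⟩
    δ≢ y a * (δ≢ x₁ a * ckWalks d (suc m) t (x₁ ∷ (rest ∷ʳ a)))
      ≡⟨ δ≢-guard y a (λ y≢a → cong (δ≢ x₁ a *_) (trans
           (ckWalks≡avoidingWalks t (x₁ ∷ (rest ∷ʳ a)) (ℕP.m≤n⇒m≤1+n t<m) (properExtension y≢a))
           (cong₂ avoidingWalks (last-∷ʳ a (x₁ ∷ rest)) (take-toList-∷ʳ t rest a (ℕP.<⇒≤ t<m))))) ⟩
    δ≢ y a * (δ≢ x₁ a * avoidingWalks a (take t (toList rest)))
      ∎
    where
    properExtension : ¬ y ≡ a → consecDistinct (x₁ ∷ (rest ∷ʳ a)) ≡ true
    properExtension y≢a = trans (consecDistinct-∷ʳ x₁ rest a)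
      (cong₂ _∧_ properTail (cong not (trans (isYes≗does (y ≟F a)) (dec-false (y ≟F a) y≢a))))

module _ {n : ℕ} where
  properWalks : ℕ → Fin n → Fin n → ℤ
  properWalks j a c = ∑[ s ∈Vec suc j ] (𝟙 (consecDistinct (a ∷ s)) * δ (last s) c)

  ΣVec-by-last : ∀ j a (g : Fin n → ℤ) →
    ∑[ s ∈Vec suc j ] (𝟙 (consecDistinct (a ∷ s)) * g (last s)) ≡ ∑[ c < n ] (properWalks j a c * g c)
  ΣVec-by-last j a g = begin
    ∑[ s ∈Vec suc j ] (𝟙 (consecDistinct (a ∷ s)) * g (last s))
      ≡⟨ ΣVec-cong (suc j) (λ s → trans (cong (𝟙 (consecDistinct (a ∷ s)) *_) (sym (∑-δ (last s) g)))
                                         (sym (∑-*ˡ (𝟙 (consecDistinct (a ∷ s))) (λ c → δ (last s) c * g c)))) ⟩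
    ∑[ s ∈Vec suc j ] ∑[ c < n ] (𝟙 (consecDistinct (a ∷ s)) * (δ (last s) c * g c))
      ≡⟨ ΣVec-∑-comm (suc j) (λ s c → 𝟙 (consecDistinct (a ∷ s)) * (δ (last s) c * g c)) ⟩
    ∑[ c < n ] ∑[ s ∈Vec suc j ] (𝟙 (consecDistinct (a ∷ s)) * (δ (last s) c * g c))
      ≡⟨ sum-cong-≗ (λ c → trans (ΣVec-cong (suc j) (λ s → sym (ℤP.*-assoc (𝟙 (consecDistinct (a ∷ s))) (δ (last s) c) (g c))))
                                  (ΣVec-*ʳ (suc j) (g c) (λ s → 𝟙 (consecDistinct (a ∷ s)) * δ (last s) c))) ⟩
    ∑[ c < n ] (properWalks j a c * g c)
      ∎

  -- pairedWalks t x y g sums g(xₜ) over the pairs of walks x = x₀, …, xₜ and y = y₀, …, yₜ without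
  -- repeated consecutive vertices such that xᵢ ≠ yᵢ for 1 ≤ i ≤ t.
  pairedWalks : ℕ → Fin n → Fin n → (Fin n → ℤ) → ℤ
  pairedWalks zero    x y g = g x
  pairedWalks (suc t) x y g = ∑[ x′ < n ] (δ≢ x x′ * ∑[ y′ < n ] (δ≢ y y′ * (δ≢ x′ y′ * pairedWalks t x′ y′ g)))

  ∑-avoidingWalks : ∀ t x y (g : Fin n → ℤ) →
    ∑[ xs ∈Vec t ] (𝟙 (consecDistinct (x ∷ xs)) * (g (last (x ∷ xs)) * avoidingWalks y (toList xs))) ≡ pairedWalks t x y g
  ∑-avoidingWalks zero    x y g = trans (ℤP.*-identityˡ _) (ℤP.*-identityʳ (g x))
  ∑-avoidingWalks (suc t) x y g = sum-cong-≗ step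
    where
    step : ∀ x₁ → ∑[ xs ∈Vec t ] (𝟙 (consecDistinct (x ∷ x₁ ∷ xs)) * (g (last (x₁ ∷ xs)) * avoidingWalks y (x₁ ∷ toList xs)))
                ≡ δ≢ x x₁ * ∑[ y′ < n ] (δ≢ y y′ * (δ≢ x₁ y′ * pairedWalks t x₁ y′ g))
    step x₁ = begin
      ∑[ xs ∈Vec t ] (𝟙 (consecDistinct (x ∷ x₁ ∷ xs)) * (g (last (x₁ ∷ xs)) * avoidingWalks y (x₁ ∷ toList xs)))
        ≡⟨ ΣVec-cong t pointwise ⟩
      ∑[ xs ∈Vec t ] (δ≢ x x₁ * ∑[ y′ < n ] (δ≢ y y′ * (δ≢ x₁ y′ * F xs y′)))
        ≡⟨ ΣVec-*ˡ t (δ≢ x x₁) _ ⟩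
      δ≢ x x₁ * ∑[ xs ∈Vec t ] ∑[ y′ < n ] (δ≢ y y′ * (δ≢ x₁ y′ * F xs y′))
        ≡⟨ cong (δ≢ x x₁ *_) (ΣVec-∑-comm t (λ xs y′ → δ≢ y y′ * (δ≢ x₁ y′ * F xs y′))) ⟩
      δ≢ x x₁ * ∑[ y′ < n ] ∑[ xs ∈Vec t ] (δ≢ y y′ * (δ≢ x₁ y′ * F xs y′))
        ≡⟨ cong (δ≢ x x₁ *_) (sum-cong-≗ (λ y′ → trans (ΣVec-*ˡ t (δ≢ y y′) _) (cong (δ≢ y y′ *_)
             (trans (ΣVec-*ˡ t (δ≢ x₁ y′) _) (cong (δ≢ x₁ y′ *_) (∑-avoidingWalks t x₁ y′ g)))))) ⟩
      δ≢ x x₁ * ∑[ y′ < n ] (δ≢ y y′ * (δ≢ x₁ y′ * pairedWalks t x₁ y′ g))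
        ∎
      where
      F : Vec (Fin n) t → Fin n → ℤ
      F xs y′ = 𝟙 (consecDistinct (x₁ ∷ xs)) * (g (last (x₁ ∷ xs)) * avoidingWalks y′ (toList xs))
      reassoc : ∀ a p q s → a * p * (q * s) ≡ a * (p * q * s)
      reassoc = solve-∀
      reorder : ∀ p q e f w → e * (f * (p * (q * w))) ≡ p * q * (e * (f * w))
      reorder = solve-∀
      pointwise : ∀ xs → 𝟙 (consecDistinct (x ∷ x₁ ∷ xs)) * (g (last (x₁ ∷ xs)) * avoidingWalks y (x₁ ∷ toList xs))
                       ≡ δ≢ x x₁ * ∑[ y′ < n ] (δ≢ y y′ * (δ≢ x₁ y′ * F xs y′))
      pointwise xs = begin
        𝟙 (not ⌊ x ≟F x₁ ⌋ ∧ consecDistinct (x₁ ∷ xs)) * (q * avoidingWalks y (x₁ ∷ toList xs))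
          ≡⟨ cong (_* (q * avoidingWalks y (x₁ ∷ toList xs))) (trans (𝟙-∧ (not ⌊ x ≟F x₁ ⌋) _) (cong (_* p) (𝟙-≢ x x₁))) ⟩
        δ≢ x x₁ * p * (q * avoidingWalks y (x₁ ∷ toList xs))
          ≡⟨ reassoc (δ≢ x x₁) p q _ ⟩
        δ≢ x x₁ * (p * q * ∑[ y′ < n ] (δ≢ y y′ * (δ≢ x₁ y′ * avoidingWalks y′ (toList xs))))
          ≡⟨ cong (δ≢ x x₁ *_) (trans (sym (∑-*ˡ (p * q) (λ y′ → δ≢ y y′ * (δ≢ x₁ y′ * avoidingWalks y′ (toList xs)))))
               (sum-cong-≗ (λ y′ → sym (reorder p q (δ≢ y y′) (δ≢ x₁ y′) (avoidingWalks y′ (toList xs)))))) ⟩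
        δ≢ x x₁ * ∑[ y′ < n ] (δ≢ y y′ * (δ≢ x₁ y′ * F xs y′))
          ∎
        where
        p = 𝟙 (consecDistinct (x₁ ∷ xs))
        q = g (last (x₁ ∷ xs))

module _ (d : ℕ) where
  private
    n = suc d
    D = + d

  offDiagonalWalks : ℕ → ℤ
  offDiagonalWalks zero    = 1ℤ
  offDiagonalWalks (suc j) = D * offDiagonalWalks j + -1ℤ ^ suc j

  properWalks-closed : ∀ j (a c : Fin n) → properWalks j a c ≡ offDiagonalWalks j + -1ℤ ^ suc j * δ a c
  properWalks-closed zero a c = begin
    ∑[ b < n ] (𝟙 (not ⌊ a ≟F b ⌋ ∧ true) * δ b c)
      ≡⟨ sum-cong-≗ (λ b → cong (_* δ b c) (trans (cong 𝟙 (∧-identityʳ _)) (𝟙-≢ a b))) ⟩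
    ∑[ b < n ] (δ≢ a b * δ b c)
      ≡⟨ ∑-δ≢ a (λ b → δ b c) ⟩
    ∑[ b < n ] δ b c - δ a c
      ≡⟨ cong (_- δ a c) (∑-δ-one c) ⟩
    1ℤ - δ a c
      ≡⟨ rearrange (δ a c) ⟩
    offDiagonalWalks zero + -1ℤ ^ 1 * δ a c
      ∎
    where
    rearrange : ∀ p → 1ℤ - p ≡ 1ℤ + (- 1ℤ) * 1ℤ * p
    rearrange = solve-∀
  properWalks-closed (suc j) a c = begin
    ∑[ b < n ] ∑[ s ∈Vec suc j ] (𝟙 (not ⌊ a ≟F b ⌋ ∧ consecDistinct (b ∷ s)) * δ (last s) c)
      ≡⟨ sum-cong-≗ (λ b → trans (ΣVec-cong (suc j) (λ s → split b s))
                                  (ΣVec-*ˡ (suc j) (δ≢ a b) (λ s → 𝟙 (consecDistinct (b ∷ s)) * δ (last s) c))) ⟩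
    ∑[ b < n ] (δ≢ a b * properWalks j b c)
      ≡⟨ sum-cong-≗ (λ b → cong (δ≢ a b *_) (properWalks-closed j b c)) ⟩
    ∑[ b < n ] (δ≢ a b * (u + v * δ b c))
      ≡⟨ ∑-δ≢ a (λ b → u + v * δ b c) ⟩
    ∑[ b < n ] (u + v * δ b c) - (u + v * δ a c)
      ≡⟨ cong (_- (u + v * δ a c)) (∑-affine u v c) ⟩
    + n * u + v - (u + v * δ a c)
      ≡⟨ rearrange D u v (δ a c) ⟩
    offDiagonalWalks (suc j) + -1ℤ ^ suc (suc j) * δ a c
      ∎
    where
    u = offDiagonalWalks j
    v = -1ℤ ^ suc j
    split : ∀ b s → 𝟙 (not ⌊ a ≟F b ⌋ ∧ consecDistinct (b ∷ s)) * δ (last s) c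
                  ≡ δ≢ a b * (𝟙 (consecDistinct (b ∷ s)) * δ (last s) c)
    split b s = trans (cong (_* δ (last s) c) (trans (𝟙-∧ (not ⌊ a ≟F b ⌋) _) (cong (_* 𝟙 (consecDistinct (b ∷ s))) (𝟙-≢ a b))))
                      (ℤP.*-assoc (δ≢ a b) _ _)
    rearrange : ∀ e u v p → (1ℤ + e) * u + v - (u + v * p) ≡ e * u + v + (- 1ℤ) * v * p
    rearrange = solve-∀

  module _ (α β : ℤ) where
    P Q R : ℕ → ℤ
    P zero    = α
    P (suc t) = (D * D - D + 1ℤ) * P t + (D - 1ℤ) * (Q t + R t)
    Q zero    = β
    Q (suc t) = R t - (D - 1ℤ) * Q t
    R zero    = 0ℤ
    R (suc t) = Q t - (D - 1ℤ) * R t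

    pairedWalks-affine : ∀ t (x y c : Fin n) → ¬ x ≡ y →
      pairedWalks t x y (λ z → α + β * δ z c) ≡ P t + Q t * δ x c + R t * δ y c
    pairedWalks-affine zero x y c x≢y = pad α β (δ x c) (δ y c)
      where
      pad : ∀ a b p q → a + b * p ≡ a + b * p + 0ℤ * q
      pad = solve-∀
    pairedWalks-affine (suc t) x y c x≢y = begin
      ∑[ x′ < n ] (δ≢ x x′ * ∑[ y′ < n ] (δ≢ y y′ * (δ≢ x′ y′ * pairedWalks t x′ y′ g)))
        ≡⟨ sum-cong-≗ (λ x′ → cong (δ≢ x x′ *_) (sum-cong-≗ (λ y′ → cong (δ≢ y y′ *_)
             (δ≢-guard x′ y′ (pairedWalks-affine t x′ y′ c))))) ⟩
      ∑[ x′ < n ] (δ≢ x x′ * ∑[ y′ < n ] (δ≢ y y′ * (δ≢ x′ y′ * G x′ y′)))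
        ≡⟨ sum-cong-≗ (λ x′ → cong (δ≢ x x′ *_) (inner x′)) ⟩
      ∑[ x′ < n ] (δ≢ x x′ * H x′)
        ≡⟨ ∑-δ≢ x H ⟩
      sum H - H x
        ≡⟨ cong₂ _-_ (trans (sum-cong-≗ H-expand) (∑-δ-quadratic a₀ a₁ a₂ a₃ c y))
                     (trans (H-expand x) (cong (λ w → a₀ + a₁ * δ x c + a₂ * w + a₃ * (w * δ x c)) (δ-≢ x≢y))) ⟩
      + n * a₀ + a₁ + a₂ + a₃ * δ y c - (a₀ + a₁ * δ x c + a₂ * 0ℤ + a₃ * (0ℤ * δ x c))
        ≡⟨ collect D (P t) (Q t) (R t) (δ x c) (δ y c) ⟩
      P (suc t) + Q (suc t) * δ x c + R (suc t) * δ y c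
        ∎
      where
      g = λ z → α + β * δ z c
      G : Fin n → Fin n → ℤ
      G x′ z = P t + Q t * δ x′ c + R t * δ z c
      H : Fin n → ℤ
      H x′ = + n * (P t + Q t * δ x′ c) + R t - G x′ y - G x′ x′ + δ x′ y * G x′ y
      inner : ∀ x′ → ∑[ y′ < n ] (δ≢ y y′ * (δ≢ x′ y′ * G x′ y′)) ≡ H x′
      inner x′ = trans (∑-δ≢-δ≢ y x′ (G x′))
        (cong (λ s → s - G x′ y - G x′ x′ + δ x′ y * G x′ y) (∑-affine (P t + Q t * δ x′ c) (R t) c))
      a₀ = + n * P t + R t - P t - R t * δ y c - P t
      a₁ = + n * Q t - Q t - Q t - R t
      a₂ = P t + R t * δ y c
      a₃ = Q t
      H-expand : ∀ z → H z ≡ a₀ + a₁ * δ z c + a₂ * δ z y + a₃ * (δ z y * δ z c)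
      H-expand z = expand (+ n) (P t) (Q t) (R t) (δ z c) (δ z y) (δ y c)
        where
        expand : ∀ m P Q R e h f → m * (P + Q * e) + R - (P + Q * e + R * f) - (P + Q * e + R * e) + h * (P + Q * e + R * f)
                   ≡ (m * P + R - P - R * f - P) + (m * Q - Q - Q - R) * e + (P + R * f) * h + Q * (h * e)
        expand = solve-∀
      collect : ∀ D P Q R e f →
          (1ℤ + D) * ((1ℤ + D) * P + R - P - R * f - P) + ((1ℤ + D) * Q - Q - Q - R) + (P + R * f) + Q * f
            - ((1ℤ + D) * P + R - P - R * f - P + ((1ℤ + D) * Q - Q - Q - R) * e + (P + R * f) * 0ℤ + Q * (0ℤ * e))
        ≡ (D * D - D + 1ℤ) * P + (D - 1ℤ) * (Q + R) + (R - (D - 1ℤ) * Q) * e + (Q - (D - 1ℤ) * R) * f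
      collect = solve-∀

module _ (d t j : ℕ) where
  private
    n = suc d
    m = t ℕ+ suc j
    α = offDiagonalWalks d j
    β = -1ℤ ^ suc j
    g : Fin n → Fin n → ℤ
    g c z = α + β * δ z c

  order-Lⁿ-CK-pairedWalks : + order (Lⁿ t (CK d (suc m))) ≡ ∑[ x < n ] ∑[ c < n ] (δ≢ x c * pairedWalks t x c (g c))
  order-Lⁿ-CK-pairedWalks = begin
    + order (Lⁿ t (CK d (suc m)))
      ≡⟨ order-Lⁿ-CK-ckWalks d m t ⟩
    ∑[ u ∈Vec suc m ] (𝟙 (isCKWord u) * ckWalks d m t u)
      ≡⟨ ΣVec-cong (suc m) (λ u → 𝟙-guard (isCKWord u) (λ ck →
           ckWalks≡avoidingWalks t u (ℕP.m<m+n t ℕP.0<1+n) (∧-conicalˡ _ _ ck))) ⟩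
    ∑[ x < n ] ∑[ r ∈Vec m ] (𝟙 (isCKWord (x ∷ r)) * avoidingWalks (last (x ∷ r)) (take t (toList r)))
      ≡⟨ sum-cong-≗ (λ x → ΣVec-++ t (suc j) (λ r → 𝟙 (isCKWord (x ∷ r)) * avoidingWalks (last (x ∷ r)) (take t (toList r)))) ⟩
    ∑[ x < n ] ∑[ xs ∈Vec t ] ∑[ s ∈Vec suc j ]
      (𝟙 (isCKWord (x ∷ (xs ++ s))) * avoidingWalks (last (x ∷ (xs ++ s))) (take t (toList (xs ++ s))))
      ≡⟨ sum-cong-≗ (λ x → ΣVec-cong t (suffix-sum x)) ⟩
    ∑[ x < n ] ∑[ xs ∈Vec t ] ∑[ c < n ] (δ≢ x c * F x xs c)
      ≡⟨ sum-cong-≗ (λ x → trans (ΣVec-∑-comm t (λ xs c → δ≢ x c * F x xs c)) (sum-cong-≗ (λ c →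
           trans (ΣVec-*ˡ t (δ≢ x c) (λ xs → F x xs c)) (cong (δ≢ x c *_) (∑-avoidingWalks t x c (g c)))))) ⟩
    ∑[ x < n ] ∑[ c < n ] (δ≢ x c * pairedWalks t x c (g c))
      ∎
    where
    F : Fin n → Vec (Fin n) t → Fin n → ℤ
    F x xs c = 𝟙 (consecDistinct (x ∷ xs)) * (g c (last (x ∷ xs)) * avoidingWalks c (toList xs))
    reassoc : ∀ p q r s → p * (q * r) * s ≡ p * (q * (r * s))
    reassoc = solve-∀
    reorder : ∀ p q r s → p * (q * (r * s)) ≡ r * (p * (q * s))
    reorder = solve-∀
    suffix-sum : ∀ x xs →
      ∑[ s ∈Vec suc j ] (𝟙 (isCKWord (x ∷ (xs ++ s))) * avoidingWalks (last (x ∷ (xs ++ s))) (take t (toList (xs ++ s))))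
      ≡ ∑[ c < n ] (δ≢ x c * F x xs c)
    suffix-sum x xs = begin
      ∑[ s ∈Vec suc j ] (𝟙 (isCKWord (x ∷ (xs ++ s))) * avoidingWalks (last (x ∷ (xs ++ s))) (take t (toList (xs ++ s))))
        ≡⟨ ΣVec-cong (suc j) (λ s → trans
             (cong₂ (λ p q → p * avoidingWalks q (take t (toList (xs ++ s)))) (isCKWord-++ x xs s) (last-++ x xs s))
             (trans (cong (λ w → p₀ * (𝟙 (consecDistinct (a ∷ s)) * δ≢ x (last s)) * avoidingWalks (last s) w) (take-toList-++ xs s))
                    (reassoc p₀ (𝟙 (consecDistinct (a ∷ s))) (δ≢ x (last s)) (avoidingWalks (last s) (toList xs))))) ⟩
      ∑[ s ∈Vec suc j ] (p₀ * (𝟙 (consecDistinct (a ∷ s)) * G (last s)))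
        ≡⟨ ΣVec-*ˡ (suc j) p₀ (λ s → 𝟙 (consecDistinct (a ∷ s)) * G (last s)) ⟩
      p₀ * ∑[ s ∈Vec suc j ] (𝟙 (consecDistinct (a ∷ s)) * G (last s))
        ≡⟨ cong (p₀ *_) (ΣVec-by-last j a G) ⟩
      p₀ * ∑[ c < n ] (properWalks j a c * G c)
        ≡⟨ cong (p₀ *_) (sum-cong-≗ (λ c → cong (_* G c) (properWalks-closed d j a c))) ⟩
      p₀ * ∑[ c < n ] (g c a * G c)
        ≡⟨ ∑-*ˡ p₀ (λ c → g c a * G c) ⟨
      ∑[ c < n ] (p₀ * (g c a * G c))
        ≡⟨ sum-cong-≗ (λ c → reorder p₀ (g c a) (δ≢ x c) (avoidingWalks c (toList xs))) ⟩
      ∑[ c < n ] (δ≢ x c * F x xs c)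
        ∎
      where
      a = last (x ∷ xs)
      p₀ = 𝟙 (consecDistinct (x ∷ xs))
      G : Fin n → ℤ
      G c = δ≢ x c * avoidingWalks c (toList xs)

  order-Lⁿ-CK : + order (Lⁿ t (CK d (suc m))) ≡ + n * (+ n * (P d α β t + R d α β t) - (P d α β t + R d α β t))
  order-Lⁿ-CK = begin
    + order (Lⁿ t (CK d (suc m)))
      ≡⟨ order-Lⁿ-CK-pairedWalks ⟩
    ∑[ x < n ] ∑[ c < n ] (δ≢ x c * pairedWalks t x c (g c))
      ≡⟨ sum-cong-≗ (λ x → sum-cong-≗ (λ c → δ≢-guard x c (λ x≢c → trans (pairedWalks-affine d α β t x c c x≢c)
           (cong₂ (λ p q → P d α β t + Q d α β t * p + R d α β t * q) (δ-≢ x≢c) (δ-refl c))))) ⟩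
    ∑[ x < n ] ∑[ c < n ] (δ≢ x c * X′)
      ≡⟨ sum-cong-≗ {n} (λ x → trans (∑-δ≢ {n} x (λ _ → X′)) (cong (_- X′) (∑-const n X′))) ⟩
    ∑[ x < n ] (+ n * X′ - X′)
      ≡⟨ ∑-const n (+ n * X′ - X′) ⟩
    + n * (+ n * X′ - X′)
      ≡⟨ cong (λ z → + n * (+ n * z - z)) (simplify (P d α β t) (Q d α β t) (R d α β t)) ⟩
    + n * (+ n * (P d α β t + R d α β t) - (P d α β t + R d α β t))
      ∎
    where
    X′ = P d α β t + Q d α β t * 0ℤ + R d α β t * 1ℤ
    simplify : ∀ p q r → p + q * 0ℤ + r * 1ℤ ≡ p + r
    simplify = solve-∀

module _ (d : ℕ) where
  private
    D = + d
    d²-d+1 = D * D - D + 1ℤ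

  offDiagonalWalks-closed : ∀ j → (1ℤ + D) * offDiagonalWalks d j ≡ D ^ suc j - -1ℤ ^ suc j
  offDiagonalWalks-closed zero = base D
    where
    base : ∀ D → (1ℤ + D) * 1ℤ ≡ D * 1ℤ - (- 1ℤ) * 1ℤ
    base = solve-∀
  offDiagonalWalks-closed (suc j) = begin
    (1ℤ + D) * (D * u + s)                   ≡⟨ distribute D u s ⟩
    D * ((1ℤ + D) * u) + (1ℤ + D) * s        ≡⟨ cong (λ p → D * p + (1ℤ + D) * s) (offDiagonalWalks-closed j) ⟩
    D * (D ^ suc j - s) + (1ℤ + D) * s       ≡⟨ collect D (D ^ suc j) s ⟩
    D * D ^ suc j - -1ℤ * s                  ∎
    where
    u = offDiagonalWalks d j
    s = -1ℤ ^ suc j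
    distribute : ∀ D u v → (1ℤ + D) * (D * u + v) ≡ D * ((1ℤ + D) * u) + (1ℤ + D) * v
    distribute = solve-∀
    collect : ∀ D p s → D * (p - s) + (1ℤ + D) * s ≡ D * p - (- 1ℤ) * s
    collect = solve-∀

  module _ (α β : ℤ) where
    Q+R-closed : ∀ t → Q d α β t + R d α β t ≡ β * (-1ℤ ^ t * (D - + 2) ^ t)
    Q+R-closed zero    = base α β
      where
      base : ∀ a b → b + 0ℤ ≡ b * (1ℤ * 1ℤ)
      base = solve-∀
    Q+R-closed (suc t) = trans (step D (Q d α β t) (R d α β t))
      (trans (cong ((- (D - + 2)) *_) (Q+R-closed t)) (shift D β (-1ℤ ^ t) ((D - + 2) ^ t)))
      where
      step : ∀ D q r → r - (D - 1ℤ) * q + (q - (D - 1ℤ) * r) ≡ (- (D - + 2)) * (q + r)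
      step = solve-∀
      shift : ∀ D b e x → (- (D - + 2)) * (b * (e * x)) ≡ b * ((- 1ℤ) * e * ((D - + 2) * x))
      shift = solve-∀

    Q-R-closed : ∀ t → Q d α β t - R d α β t ≡ β * (-1ℤ ^ t * D ^ t)
    Q-R-closed zero    = base α β
      where
      base : ∀ a b → b - 0ℤ ≡ b * (1ℤ * 1ℤ)
      base = solve-∀
    Q-R-closed (suc t) = trans (step D (Q d α β t) (R d α β t)) (trans (cong ((- D) *_) (Q-R-closed t)) (shift D β (-1ℤ ^ t) (D ^ t)))
      where
      step : ∀ D q r → r - (D - 1ℤ) * q - (q - (D - 1ℤ) * r) ≡ (- D) * (q - r)
      step = solve-∀
      shift : ∀ D b e x → (- D) * (b * (e * x)) ≡ b * ((- 1ℤ) * e * (D * x))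
      shift = solve-∀

    P-closed : ∀ t → (1ℤ + D) * P d α β t ≡ (1ℤ + D) * α * d²-d+1 ^ t + β * (d²-d+1 ^ t - -1ℤ ^ t * (D - + 2) ^ t)
    P-closed zero    = base D α β
      where
      base : ∀ D a b → (1ℤ + D) * a ≡ (1ℤ + D) * a * 1ℤ + b * (1ℤ - 1ℤ * 1ℤ)
      base = solve-∀
    P-closed (suc t) = begin
      (1ℤ + D) * (d²-d+1 * P d α β t + (D - 1ℤ) * (Q d α β t + R d α β t))
        ≡⟨ distribute D (P d α β t) (Q d α β t + R d α β t) ⟩
      d²-d+1 * ((1ℤ + D) * P d α β t) + (1ℤ + D) * (D - 1ℤ) * (Q d α β t + R d α β t)
        ≡⟨ cong₂ (λ p q → d²-d+1 * p + (1ℤ + D) * (D - 1ℤ) * q) (P-closed t) (Q+R-closed t) ⟩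
      d²-d+1 * ((1ℤ + D) * α * d²-d+1 ^ t + β * (d²-d+1 ^ t - b)) + (1ℤ + D) * (D - 1ℤ) * (β * b)
        ≡⟨ collect D α β (d²-d+1 ^ t) (-1ℤ ^ t) ((D - + 2) ^ t) ⟩
      (1ℤ + D) * α * (d²-d+1 * d²-d+1 ^ t) + β * (d²-d+1 * d²-d+1 ^ t - -1ℤ * -1ℤ ^ t * ((D - + 2) * (D - + 2) ^ t))
        ∎
      where
      b = -1ℤ ^ t * (D - + 2) ^ t
      distribute : ∀ D p s → (1ℤ + D) * ((D * D - D + 1ℤ) * p + (D - 1ℤ) * s)
                           ≡ (D * D - D + 1ℤ) * ((1ℤ + D) * p) + (1ℤ + D) * (D - 1ℤ) * s
      distribute = solve-∀
      collect : ∀ D a b x e y →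
          (D * D - D + 1ℤ) * ((1ℤ + D) * a * x + b * (x - e * y)) + (1ℤ + D) * (D - 1ℤ) * (b * (e * y))
        ≡ (1ℤ + D) * a * ((D * D - D + 1ℤ) * x) + b * ((D * D - D + 1ℤ) * x - (- 1ℤ) * e * ((D - + 2) * y))
      collect = solve-∀

module _ (d t j : ℕ) where
  private
    D = + d
    ℓ = suc (t ℕ+ suc j)
    α = offDiagonalWalks d j
    p = P d α (-1ℤ ^ suc j) t
    q = Q d α (-1ℤ ^ suc j) t
    r = R d α (-1ℤ ^ suc j) t
    aᵗ = (D * D - D + 1ℤ) ^ t
    bᵗ = (D - + 2) ^ t
    dᵗ = D ^ t
    dʲ⁺¹ = D ^ suc j
    εᵗ = -1ℤ ^ t
    εʲ⁺¹ = -1ℤ ^ suc j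
    common : ℤ
    common = + 2 * D * (1ℤ + D) * ((dʲ⁺¹ - εʲ⁺¹) * aᵗ + εʲ⁺¹ * (aᵗ - εᵗ * bᵗ))
           + D * (1ℤ + D) * (1ℤ + D) * (εʲ⁺¹ * (εᵗ * bᵗ) - εʲ⁺¹ * (εᵗ * dᵗ))
    formula : ℤ → ℤ → ℤ → ℤ → ℤ
    formula dˡ⁻ᵗ εˡ⁺¹ εˡ dᵗ⁺¹ = + 2 * (aᵗ * dˡ⁻ᵗ) + εˡ⁺¹ * bᵗ * (D - + 1) * D + εˡ * dᵗ⁺¹ * (D + + 1)

  twice-order-scaled : (1ℤ + D) * (+ 2 * + order (Lⁿ t (CK d ℓ))) ≡ common
  twice-order-scaled = begin
    (1ℤ + D) * (+ 2 * + order (Lⁿ t (CK d ℓ)))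
      ≡⟨ cong (λ z → (1ℤ + D) * (+ 2 * z)) (order-Lⁿ-CK d t j) ⟩
    (1ℤ + D) * (+ 2 * ((1ℤ + D) * ((1ℤ + D) * (p + r) - (p + r))))
      ≡⟨ separate D p q r ⟩
    + 2 * D * (1ℤ + D) * ((1ℤ + D) * p) + D * (1ℤ + D) * (1ℤ + D) * ((q + r) - (q - r))
      ≡⟨ cong₂ (λ x y → + 2 * D * (1ℤ + D) * x + D * (1ℤ + D) * (1ℤ + D) * y)
               (P-closed d α εʲ⁺¹ t) (cong₂ _-_ (Q+R-closed d α εʲ⁺¹ t) (Q-R-closed d α εʲ⁺¹ t)) ⟩
    + 2 * D * (1ℤ + D) * ((1ℤ + D) * α * aᵗ + εʲ⁺¹ * (aᵗ - εᵗ * bᵗ))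
      + D * (1ℤ + D) * (1ℤ + D) * (εʲ⁺¹ * (εᵗ * bᵗ) - εʲ⁺¹ * (εᵗ * dᵗ))
      ≡⟨ cong (λ x → + 2 * D * (1ℤ + D) * (x * aᵗ + εʲ⁺¹ * (aᵗ - εᵗ * bᵗ))
                     + D * (1ℤ + D) * (1ℤ + D) * (εʲ⁺¹ * (εᵗ * bᵗ) - εʲ⁺¹ * (εᵗ * dᵗ)))
              (offDiagonalWalks-closed d j) ⟩
    common
      ∎
    where
    -- 2 (p + r) = 2 p + (q + r) - (q - r)
    separate : ∀ D p q r → (1ℤ + D) * (+ 2 * ((1ℤ + D) * ((1ℤ + D) * (p + r) - (p + r))))
                         ≡ + 2 * D * (1ℤ + D) * ((1ℤ + D) * p) + D * (1ℤ + D) * (1ℤ + D) * ((q + r) - (q - r))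
    separate = solve-∀

  formula-scaled : (1ℤ + D) * formula (D ^ (ℓ ∸ t)) (-1ℤ ^ (ℓ ℕ+ 1)) (-1ℤ ^ ℓ) (D ^ (t ℕ+ 1)) ≡ common
  formula-scaled = begin
    (1ℤ + D) * formula (D ^ (ℓ ∸ t)) (-1ℤ ^ (ℓ ℕ+ 1)) (-1ℤ ^ ℓ) (D ^ (t ℕ+ 1))
      ≡⟨ cong₂ (λ x y → (1ℤ + D) * formula x y (-1ℤ ^ ℓ) (D ^ (t ℕ+ 1)))
               (cong (D ^_) ℓ∸t≡2+j) (trans (ℤP.^-distribˡ-+-* -1ℤ ℓ 1) (cong (_* (-1ℤ * 1ℤ)) εˡ≡)) ⟩
    (1ℤ + D) * formula (D * dʲ⁺¹) (-1ℤ * (εᵗ * εʲ⁺¹) * (-1ℤ * 1ℤ)) (-1ℤ ^ ℓ) (D ^ (t ℕ+ 1))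
      ≡⟨ cong₂ (λ x y → (1ℤ + D) * formula (D * dʲ⁺¹) (-1ℤ * (εᵗ * εʲ⁺¹) * (-1ℤ * 1ℤ)) x y)
               εˡ≡ (ℤP.^-distribˡ-+-* D t 1) ⟩
    (1ℤ + D) * formula (D * dʲ⁺¹) (-1ℤ * (εᵗ * εʲ⁺¹) * (-1ℤ * 1ℤ)) (-1ℤ * (εᵗ * εʲ⁺¹)) (dᵗ * (D * 1ℤ))
      ≡⟨ expand D aᵗ bᵗ dᵗ dʲ⁺¹ εᵗ εʲ⁺¹ ⟩
    common
      ∎
    where
    ℓ∸t≡2+j : ℓ ∸ t ≡ suc (suc j)
    ℓ∸t≡2+j = trans (cong (_∸ t) (sym (ℕP.+-suc t (suc j)))) (ℕP.m+n∸m≡n t (suc (suc j)))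
    εˡ≡ : -1ℤ ^ ℓ ≡ -1ℤ * (εᵗ * εʲ⁺¹)
    εˡ≡ = cong (-1ℤ *_) (ℤP.^-distribˡ-+-* -1ℤ t (suc j))
    expand : ∀ D aᵗ bᵗ dᵗ dʲ⁺¹ εᵗ εʲ⁺¹ →
        (1ℤ + D) * (+ 2 * (aᵗ * (D * dʲ⁺¹)) + (- 1ℤ) * (εᵗ * εʲ⁺¹) * ((- 1ℤ) * 1ℤ) * bᵗ * (D - + 1) * D
                    + (- 1ℤ) * (εᵗ * εʲ⁺¹) * (dᵗ * (D * 1ℤ)) * (D + + 1))
      ≡ + 2 * D * (1ℤ + D) * ((dʲ⁺¹ - εʲ⁺¹) * aᵗ + εʲ⁺¹ * (aᵗ - εᵗ * bᵗ))
        + D * (1ℤ + D) * (1ℤ + D) * (εʲ⁺¹ * (εᵗ * bᵗ) - εʲ⁺¹ * (εᵗ * dᵗ))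
    expand = solve-∀

length-split : ∀ {ℓ t} → 2 ≤ ℓ → t ≤ ℓ ∸ 2 → Σ ℕ (λ j → ℓ ≡ suc (t ℕ+ suc j))
length-split {suc (suc k)} {t} (s≤s (s≤s _)) t≤k =
  k ∸ t , cong suc (sym (trans (ℕP.+-suc t (k ∸ t)) (cong suc (ℕP.m+[n∸m]≡n t≤k))))

theorem15 : (d ℓ t : ℕ) → 3 ≤ ℓ → 1 ≤ d → 1 ≤ t → t ≤ ℓ ∸ 2 →
    (+ 2) * (+ (order (Lⁿ t (CK d ℓ))))
      ≡ (+ 2) * ((((+ d) * (+ d) - (+ d) + (+ 1)) ^ t) * ((+ d) ^ (ℓ ∸ t)))
        + (-[1+ 0 ] ^ (Data.Nat._+_ ℓ 1)) * (((+ d) - (+ 2)) ^ t) * ((+ d) - (+ 1)) * (+ d)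
        + (-[1+ 0 ] ^ ℓ) * ((+ d) ^ (Data.Nat._+_ t 1)) * ((+ d) + (+ 1))
theorem15 d ℓ t 3≤ℓ _ _ t≤ℓ∸2 with length-split (ℕP.<⇒≤ 3≤ℓ) t≤ℓ∸2
... | j , refl = ℤP.*-cancelˡ-≡ (1ℤ + + d) _ _ (trans (twice-order-scaled d t j) (sym (formula-scaled d t j)))
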